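{- Let $\pi$ be a play in $G'$ from $(s_{\mathrm{init}},0)$ with $\overline{\mathrm{MP}}(\pi)\le t$. Then there exist $1\le i\le j$ such that $\pi_{[i,j]}$ is a good cycle.
   Context: $G=(S_0,S_1,E)$ is a finite weighted game ($S=S_0\cup S_1$ finite, $E\subseteq S\times\mathbb Z\times S$ finite, every state with an outgoing edge), $s_{\mathrm{init}}\in S$, and $t=t_1/t_2$ with $t_1,t_2\in\mathbb N$, $t_2\ge1$. The expanded game $G'$ has configurations $(S\times\mathbb N)\uplus\{\bot\}$ and edges: $((s,c),c',(s',c'))$ whenever $(s,w,s')\in E$ and $c'=c+w\ge0$; $((s,c),\lceil t\rceil+1,\bot)$ whenever some $(s,w,s')\in E$ has $c+w<0$; and $(\bot,\lceil t\rceil+1,\bot)$. A play is an infinite edge sequence $e_1e_2\cdots$ with $\mathrm{tgt}(e_i)=\mathrm{src}(e_{i+1})$; $\overline{\mathrm{MP}}(\pi)=\limsup_n\frac1n\sum_{i=1}^n w(e_i)$; $\pi_{[i,j]}=e_i\cdots e_j$. For a finite nonempty prefix $\rho=f_1\cdots f_m$, $\mathrm{MP}(\rho)=\frac1m\sum_{i=1}^m w(f_i)$; it is a cycle if $\mathrm{tgt}(f_m)=\mathrm{src}(f_1)$. A good cycle is a cycle $\rho$ whose first configuration $\mathrm{src}(f_1)=(s_0,c_0)$ satisfies $c_0\le t$ and with $\mathrm{MP}(\rho)\le t$. -}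

module Defs where

open import Data.Nat as ℕ using (ℕ; zero; suc; NonZero)
open import Data.Integer as ℤ using (ℤ; +_)
open import Data.Rational as ℚ using (ℚ; ceiling)
open import Data.Fin using (Fin)
open import Data.Bool using (Bool)
open import Data.List using (List)
open import Data.List.Membership.Propositional using (_∈_)
open import Data.Product using (Σ; ∃; _×_; _,_; proj₁; proj₂)
open import Relation.Binary.PropositionalEquality using (_≡_)

-- A finite weighted game G = (S₀, S₁, E) with S = Fin n.
-- S₀ is the set of states with isS₀ s ≡ true, S₁ its complement.
-- E is a finite list of edges (s , w , s').
Edge : ℕ → Set
Edge n = Fin n × ℤ × Fin n

record Game (n : ℕ) : Set where
  field
    isS₀  : Fin n → Bool
    edges : List (Edge n)
    total : (s : Fin n) → Σ ℤ λ w → Σ (Fin n) λ s' → (s , w , s') ∈ edges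

open Game public

thr : (t₁ t₂ : ℕ) → .{{NonZero t₂}} → ℚ
thr t₁ t₂ = (+ t₁) ℚ./ t₂

data Conf (n : ℕ) : Set where
  cfg : Fin n → ℕ → Conf n
  bot : Conf n

Edge' : ℕ → Set
Edge' n = Conf n × ℤ × Conf n

src : ∀ {n} → Edge' n → Conf n
src e = proj₁ e

wt : ∀ {n} → Edge' n → ℤ
wt e = proj₁ (proj₂ e)

tgt : ∀ {n} → Edge' n → Conf n
tgt e = proj₂ (proj₂ e)

data IsEdge' {n : ℕ} (G : Game n) (t : ℚ) : Edge' n → Set where
  step : ∀ {s w s' c c'} → (s , w , s') ∈ edges G →
         (+ c) ℤ.+ w ≡ + c' →
         IsEdge' G t (cfg s c , + c' , cfg s' c')
  toBot : ∀ {s w s' c} → (s , w , s') ∈ edges G →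
         (+ c) ℤ.+ w ℤ.< + 0 →
         IsEdge' G t (cfg s c , ceiling t ℤ.+ + 1 , bot)
  botLoop : IsEdge' G t (bot , ceiling t ℤ.+ + 1 , bot)

-- plays in G' starting from a configuration: π i is the (i+1)-th edge e_{i+1}
record Play {n : ℕ} (G : Game n) (t : ℚ) (c₀ : Conf n) : Set where
  field
    edge    : ℕ → Edge' n
    valid   : ∀ i → IsEdge' G t (edge i)
    start   : src (edge 0) ≡ c₀
    connect : ∀ i → tgt (edge i) ≡ src (edge (suc i))

open Play public

wsum : ∀ {n} → (ℕ → Edge' n) → ℕ → ℕ → ℤ
wsum π i zero = + 0
wsum π i (suc k) = wt (π i) ℤ.+ wsum π (suc i) k

mpSeg : ∀ {n} → (ℕ → Edge' n) → ℕ → ℕ → ℚ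
mpSeg π i k = wsum π i (suc k) ℚ./ suc k

-- limsup_n (1/n) Σ_{i=1}^n w(e_i) ≤ t, unfolded with rational ε:
-- for every ε > 0 there is N with average of the first m edges ≤ t + ε for all m ≥ N.
LimsupMP≤ : ∀ {n} → (ℕ → Edge' n) → ℚ → Set
LimsupMP≤ π t = (ε : ℚ) → ℚ.0ℚ ℚ.< ε →
  Σ ℕ λ N → (m : ℕ) → N ℕ.≤ m → mpSeg π 0 m ℚ.≤ t ℚ.+ ε

-- the segment π i ... π j (i ≤ j, 0-based) is a good cycle
GoodCycle : ∀ {n} → (ℕ → Edge' n) → ℚ → ℕ → ℕ → Set
GoodCycle π t i j =
  tgt (π j) ≡ src (π i) ×
  (Σ _ λ s → Σ ℕ λ c → src (π i) ≡ cfg s c × (+ c) ℚ./ 1 ℚ.≤ t) ×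
  mpSeg π i (j ℕ.∸ i) ℚ.≤ t

module Submission where

-- Shift the weights to x = D·w − T, where t = T/D: a segment has mean payoff ≤ t iff its
-- shifted weight is ≤ 0.  Mark each position of the play whose target has counter ≤ t by
-- that (state, counter) pair; there are finitely many marks.  Unmarked positions have
-- x ≥ 1, all positions have x ≥ −T, and a segment between two equal marks with shifted
-- weight ≤ 0 is a good cycle.  So if a finite horizon N contains no such segment, every
-- segment between equal marks below N has shifted weight ≥ 1.
--
-- The combinatorial core (module Revisits) shows that then every window below N is
-- linearly bounded: length ≤ B·(shifted weight) + A, with B, A depending only on T and the
-- list of marks, by induction on that list — between consecutive visits of one mark the
-- offset is absorbed into the slope.  A linear bound over a long prefix forces its mean
-- payoff above t + 1/(1 + B·D), against the limsup hypothesis; hence for N large enough a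
-- good cycle below N exists, and bounded search finds it.

open import Defs
open import Data.Nat using (ℕ; NonZero; _≤_)
open import Data.Fin using (Fin)
open import Data.Product using (Σ; _×_)

open import Data.Nat as ℕ using (zero; suc; z≤n; s≤s; _<_)
import Data.Nat.Properties as ℕP
open import Data.Nat.Induction using (<-rec)
import Data.Nat.Tactic.RingSolver as ℕSolver
open import Data.Integer using (ℤ; +_; -[1+_]; +≤+; +<+; 0ℤ; 1ℤ; _+_; _*_; _-_; -_)
  renaming (_≤_ to _≤ᶻ_; _≤?_ to _≤ᶻ?_)
import Data.Integer.Properties as ℤP
import Data.Integer.DivMod as ℤD
open import Data.Integer.GCD using (gcd)
open import Data.Integer.Tactic.RingSolver using (solve-∀)
import Data.Rational as ℚ
import Data.Rational.Properties as ℚP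
import Data.Rational.Unnormalised as ℚᵘ
import Data.Rational.Unnormalised.Properties as ℚᵘP
import Data.Fin as Fin
open import Data.List using (List; []; _∷_; cartesianProduct; allFin; upTo)
open import Data.List.Membership.Propositional using (_∈_)
open import Data.List.Membership.Propositional.Properties using (∈-cartesianProduct⁺; ∈-allFin; ∈-upTo⁺)
open import Data.List.Relation.Unary.Any using (here; there)
open import Data.Maybe using (Maybe; just; nothing)
import Data.Maybe.Properties as MaybeP
open import Data.Product using (∃; _,_; proj₁; proj₂)
open import Data.Product.Properties using () renaming (≡-dec to ×-≡-dec)
open import Data.Sum using (_⊎_; inj₁; inj₂)
open import Data.Empty using (⊥-elim)
open import Function using (_$_)
open import Relation.Nullary using (¬_; Dec; yes; no)
open import Relation.Nullary.Decidable using (_×-dec_)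
open import Relation.Binary.Definitions using (DecidableEquality)
open import Relation.Binary.PropositionalEquality

sumFrom : (ℕ → ℤ) → ℕ → ℕ → ℤ
sumFrom f a zero    = 0ℤ
sumFrom f a (suc l) = f a + sumFrom f (suc a) l

sumFrom-split : ∀ f a m n → sumFrom f a (m ℕ.+ n) ≡ sumFrom f a m + sumFrom f (a ℕ.+ m) n
sumFrom-split f a zero n = begin
  sumFrom f a n               ≡⟨ cong (λ b → sumFrom f b n) (sym (ℕP.+-identityʳ a)) ⟩
  sumFrom f (a ℕ.+ 0) n       ≡⟨ sym (ℤP.+-identityˡ _) ⟩
  0ℤ + sumFrom f (a ℕ.+ 0) n  ∎
  where open ≡-Reasoning
sumFrom-split f a (suc m) n = begin
  f a + sumFrom f (suc a) (m ℕ.+ n)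
    ≡⟨ cong (λ s → f a + s) (sumFrom-split f (suc a) m n) ⟩
  f a + (sumFrom f (suc a) m + sumFrom f (suc a ℕ.+ m) n)
    ≡⟨ sym (ℤP.+-assoc (f a) _ _) ⟩
  (f a + sumFrom f (suc a) m) + sumFrom f (suc a ℕ.+ m) n
    ≡⟨ cong (λ b → (f a + sumFrom f (suc a) m) + sumFrom f b n) (sym (ℕP.+-suc a m)) ⟩
  (f a + sumFrom f (suc a) m) + sumFrom f (a ℕ.+ suc m) n ∎
  where open ≡-Reasoning

sumFrom-affine : ∀ (D T : ℤ) w a l →
  sumFrom (λ i → D * w i - T) a l ≡ D * sumFrom w a l - T * + l
sumFrom-affine D T w a zero = sym (zero-form D T)
  where
  zero-form : ∀ d t → d * 0ℤ - t * 0ℤ ≡ 0ℤ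
  zero-form = solve-∀
sumFrom-affine D T w a (suc l) = begin
  (D * w a - T) + sumFrom (λ i → D * w i - T) (suc a) l
    ≡⟨ cong (λ s → (D * w a - T) + s) (sumFrom-affine D T w (suc a) l) ⟩
  (D * w a - T) + (D * sumFrom w (suc a) l - T * + l)
    ≡⟨ regroup D (w a) (sumFrom w (suc a) l) T (+ l) ⟩
  D * (w a + sumFrom w (suc a) l) - T * (1ℤ + + l) ∎
  where
  open ≡-Reasoning
  regroup : ∀ d v s t k → (d * v - t) + (d * s - t * k) ≡ d * (v + s) - t * (1ℤ + k)
  regroup = solve-∀

module Linear (f : ℕ → ℤ) where

  record Bound (B A a l : ℕ) : Set where
    constructor bound
    field bounded : + l ≤ᶻ + B * sumFrom f a l + + A

  bound-weaken : ∀ {B A A' a l} → A ℕ.≤ A' → Bound B A a l → Bound B A' a l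
  bound-weaken {B} {a = a} {l} A≤A' (bound h) = bound (ℤP.≤-trans h (ℤP.+-monoʳ-≤ (+ B * sumFrom f a l) (+≤+ A≤A')))

  bound-scale : ∀ c {B A a l} → Bound B A a l → Bound (suc c ℕ.* B) (suc c ℕ.* A) a l
  bound-scale c {B} {A} {a} {l} (bound h) = bound $ begin
    + l                                   ≤⟨ +≤+ (ℕP.m≤n*m l (suc c)) ⟩
    + (suc c ℕ.* l)                       ≡⟨ ℤP.pos-* (suc c) l ⟩
    + suc c * + l                         ≤⟨ ℤP.*-monoˡ-≤-nonNeg (+ suc c) h ⟩
    + suc c * (+ B * S + + A)             ≡⟨ distrib (+ suc c) (+ B) S (+ A) ⟩
    (+ suc c * + B) * S + + suc c * + A   ≡⟨ cong₂ (λ u v → u * S + v) (sym (ℤP.pos-* (suc c) B)) (sym (ℤP.pos-* (suc c) A)) ⟩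
    + (suc c ℕ.* B) * S + + (suc c ℕ.* A) ∎
    where
    open ℤP.≤-Reasoning
    S : ℤ
    S = sumFrom f a l
    distrib : ∀ k b s a → k * (b * s + a) ≡ (k * b) * s + k * a
    distrib = solve-∀

  bound-append : ∀ {B A₁ A₂ a l₁ l₂} → Bound B A₁ a l₁ → Bound B A₂ (a ℕ.+ l₁) l₂ →
                 Bound B (A₁ ℕ.+ A₂) a (l₁ ℕ.+ l₂)
  bound-append {B} {A₁} {A₂} {a} {l₁} {l₂} (bound h₁) (bound h₂) = bound $ begin
    + (l₁ ℕ.+ l₂)                         ≡⟨ ℤP.pos-+ l₁ l₂ ⟩
    + l₁ + + l₂                           ≤⟨ ℤP.+-mono-≤ h₁ h₂ ⟩
    (+ B * S₁ + + A₁) + (+ B * S₂ + + A₂) ≡⟨ regroup (+ B) S₁ S₂ (+ A₁) (+ A₂) ⟩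
    + B * (S₁ + S₂) + (+ A₁ + + A₂)       ≡⟨ cong₂ (λ s k → + B * s + k) (sym (sumFrom-split f a l₁ l₂)) (sym (ℤP.pos-+ A₁ A₂)) ⟩
    + B * sumFrom f a (l₁ ℕ.+ l₂) + + (A₁ ℕ.+ A₂) ∎
    where
    open ℤP.≤-Reasoning
    S₁ S₂ : ℤ
    S₁ = sumFrom f a l₁
    S₂ = sumFrom f (a ℕ.+ l₁) l₂
    regroup : ∀ b s₁ s₂ a₁ a₂ → (b * s₁ + a₁) + (b * s₂ + a₂) ≡ b * (s₁ + s₂) + (a₁ + a₂)
    regroup = solve-∀

  bound-single : ∀ {B T i} → - + T ≤ᶻ f i → Bound B (B ℕ.* T ℕ.+ 1) i 1
  bound-single {B} {T} {i} f≥-T = bound $ begin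
    + 1                                  ≡⟨ cancel (+ B) (+ T) ⟩
    + B * - + T + (+ B * + T + 1ℤ)       ≤⟨ ℤP.+-mono-≤ (ℤP.*-monoˡ-≤-nonNeg (+ B) f≥-T) (ℤP.≤-reflexive (cong (_+ 1ℤ) (sym (ℤP.pos-* B T)))) ⟩
    + B * f i + (+ (B ℕ.* T) + 1ℤ)       ≡⟨ cong₂ (λ s k → + B * s + k) (sym (ℤP.+-identityʳ (f i))) (sym (ℤP.pos-+ (B ℕ.* T) 1)) ⟩
    + B * (f i + 0ℤ) + + (B ℕ.* T ℕ.+ 1) ∎
    where
    open ℤP.≤-Reasoning
    cancel : ∀ b t → 1ℤ ≡ b * - t + (b * t + 1ℤ)
    cancel = solve-∀

  bound-extend : ∀ {B A T a l} → Bound B A a l → - + T ≤ᶻ f (a ℕ.+ l) →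
                 Bound B (A ℕ.+ (B ℕ.* T ℕ.+ 1)) a (suc l)
  bound-extend {a = a} {l} h f≥-T =
    subst (Bound _ _ a) (ℕP.+-comm l 1) (bound-append h (bound-single f≥-T))

  bound-absorb : ∀ {B A a l} → 1 ℕ.≤ B → 1ℤ ≤ᶻ sumFrom f a l → Bound B A a l →
                 Bound (suc A ℕ.* B) 0 a l
  bound-absorb {B} {A} {a} {l} B≥1 S≥1 (bound h) = bound $ begin
    + l                           ≤⟨ h ⟩
    + B * S + + A                 ≡⟨ cong (λ k → + B * S + k) (sym (ℤP.*-identityʳ (+ A))) ⟩
    + B * S + + A * 1ℤ            ≤⟨ ℤP.+-monoʳ-≤ (+ B * S) (ℤP.*-monoˡ-≤-nonNeg (+ A) BS≥1) ⟩
    + B * S + + A * (+ B * S)     ≡⟨ regroup (+ A) (+ B) S ⟩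
    (+ suc A * + B) * S + 0ℤ      ≡⟨ cong (λ k → k * S + 0ℤ) (sym (ℤP.pos-* (suc A) B)) ⟩
    + (suc A ℕ.* B) * S + 0ℤ      ∎
    where
    open ℤP.≤-Reasoning
    S : ℤ
    S = sumFrom f a l
    BS≥1 : 1ℤ ≤ᶻ + B * S
    BS≥1 = ℤP.≤-trans (+≤+ B≥1) (ℤP.≤-trans (ℤP.≤-reflexive (sym (ℤP.*-identityʳ (+ B)))) (ℤP.*-monoˡ-≤-nonNeg (+ B) S≥1))
    regroup : ∀ a b s → b * s + a * (b * s) ≡ ((1ℤ + a) * b) * s + 0ℤ
    regroup = solve-∀

data Least (P : ℕ → Set) (l : ℕ) : Set where
  absent : (∀ j → j < l → ¬ P j) → Least P l
  least  : ∀ d → d < l → P d → (∀ j → j < d → ¬ P j) → Least P l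

search : ∀ {P : ℕ → Set} → (∀ j → Dec (P j)) → ∀ l → Least P l
search P? zero = absent (λ _ ())
search {P} P? (suc l) with search P? l
... | least d d<l p before = least d (ℕP.m<n⇒m<1+n d<l) p before
... | absent none with P? l
...   | yes p = least l (ℕP.n<1+n l) p none
...   | no ¬p = absent λ j j<1+l → case-split j (ℕP.m<1+n⇒m<n∨m≡n j<1+l)
  where
  case-split : ∀ j → j < l ⊎ j ≡ l → ¬ P j
  case-split j (inj₁ j<l) = none j j<l
  case-split j (inj₂ refl) = ¬p

search? : ∀ {P : ℕ → Set} → (∀ j → Dec (P j)) → ∀ l → Dec (∃ λ j → j < l × P j)
search? P? l with search P? l
... | absent none = no λ (j , j<l , p) → none j j<l p
... | least d d<l p _ = yes (d , d<l , p)

record Coefficients : Set where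
  constructor coefficients
  field
    slope offset : ℕ
open Coefficients

-- Offset after appending a position of weight ≥ −T; its successor is the growth factor of a level.
extendedOffset : ℕ → Coefficients → ℕ
extendedOffset T C = offset C ℕ.+ (slope C ℕ.* T ℕ.+ 1)

nextCoefficients : ℕ → Coefficients → Coefficients
nextCoefficients T C = coefficients B' (suc c ℕ.* offset C ℕ.+ (B' ℕ.* T ℕ.+ 1) ℕ.+ suc c ℕ.* offset C)
  where
  c B' : ℕ
  c  = extendedOffset T C
  B' = suc c ℕ.* slope C

coefficientsFor : ∀ {L : Set} → ℕ → List L → Coefficients
coefficientsFor T []       = coefficients 1 0
coefficientsFor T (_ ∷ Ls) = nextCoefficients T (coefficientsFor T Ls)

slope-pos : ∀ {L : Set} T (Ls : List L) → 1 ℕ.≤ slope (coefficientsFor T Ls)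
slope-pos T []       = s≤s z≤n
slope-pos T (_ ∷ Ls) =
  ℕP.≤-trans (slope-pos T Ls) (ℕP.m≤n*m _ (suc (extendedOffset T (coefficientsFor T Ls))))

module Revisits {L : Set} (_≟_ : DecidableEquality L) (mark : ℕ → Maybe L)
  (x : ℕ → ℤ) (T : ℕ)
  (unmarked-pos : ∀ i → mark i ≡ nothing → 1ℤ ≤ᶻ x i)
  (x-lower : ∀ i → - + T ≤ᶻ x i)
  (N : ℕ)
  (revisit-pos : ∀ u d {κ} → suc u ℕ.+ d < N → mark u ≡ just κ → mark (suc u ℕ.+ d) ≡ just κ →
                 1ℤ ≤ᶻ sumFrom x (suc u) (suc d)) where

  open Linear x

  MarksIn : List L → ℕ → ℕ → Set
  MarksIn Ls a l = ∀ j → j < l → ∀ {κ} → mark (a ℕ.+ j) ≡ just κ → κ ∈ Ls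

  marks-prefix : ∀ {Ls a l d} → d ℕ.≤ l → MarksIn Ls a l → MarksIn Ls a d
  marks-prefix d≤l win j j<d = win j (ℕP.<-≤-trans j<d d≤l)

  marks-suffix : ∀ {Ls a} m {r} → MarksIn Ls a (m ℕ.+ r) → MarksIn Ls (a ℕ.+ m) r
  marks-suffix {a = a} m win j j<r rewrite ℕP.+-assoc a m j = win (m ℕ.+ j) (ℕP.+-monoʳ-< m j<r)

  marks-tail : ∀ {Ls a l} → MarksIn Ls a (suc l) → MarksIn Ls (suc a) l
  marks-tail {a = a} win j j<l rewrite sym (ℕP.+-suc a j) = win (suc j) (s≤s j<l)

  marks-avoid : ∀ {κ Ls a l} → (∀ j → j < l → ¬ mark (a ℕ.+ j) ≡ just κ) →
                MarksIn (κ ∷ Ls) a l → MarksIn Ls a l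
  marks-avoid avoid win j j<l eq with win j j<l eq
  ... | here refl   = ⊥-elim (avoid j j<l eq)
  ... | there κ∈Ls = κ∈Ls

  head-unmarked : ∀ {a l} → MarksIn [] a (suc l) → mark a ≡ nothing
  head-unmarked {a} win with mark a in eq
  ... | nothing = refl
  ... | just κ with win 0 (s≤s z≤n) (trans (cong mark (ℕP.+-identityʳ a)) eq)
  ...   | ()

  unmarked-weight : ∀ a l → MarksIn [] a l → + l ≤ᶻ sumFrom x a l
  unmarked-weight a zero    _   = ℤP.≤-refl
  unmarked-weight a (suc l) win =
    ℤP.+-mono-≤ (unmarked-pos a (head-unmarked win)) (unmarked-weight (suc a) l (marks-tail win))

  unmarked-bound : ∀ a l → MarksIn [] a l → Bound 1 0 a l
  unmarked-bound a l win = bound (subst (+ l ≤ᶻ_) (sym (unit (sumFrom x a l))) (unmarked-weight a l win))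
    where
    unit : ∀ s → 1ℤ * s + 0ℤ ≡ s
    unit = solve-∀

  module Level (κ : L) (Ls : List L)
    (inner : ∀ a l → a ℕ.+ l ≤ N → MarksIn Ls a l →
             Bound (slope (coefficientsFor T Ls)) (offset (coefficientsFor T Ls)) a l) where

    C : Coefficients
    C  = coefficientsFor T Ls
    B A c B' : ℕ
    B  = slope C
    A  = offset C
    c  = extendedOffset T C
    B' = suc c ℕ.* B

    visit? : ∀ i → Dec (mark i ≡ just κ)
    visit? i = MaybeP.≡-dec _≟_ (mark i) (just κ)

    -- A segment from a visit of κ to the next one has weight ≥ 1, so its bound needs no offset.
    gap-bound : ∀ u d → suc u ℕ.+ d < N → mark u ≡ just κ → mark (suc u ℕ.+ d) ≡ just κ →
                MarksIn Ls (suc u) d → Bound B' 0 (suc u) (suc d)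
    gap-bound u d lt mu mv win = bound-absorb (slope-pos T Ls) (revisit-pos u d lt mu mv)
      (bound-extend (inner (suc u) d (ℕP.<⇒≤ lt) win) (x-lower (suc u ℕ.+ d)))

    position-after : ∀ u d r → u ℕ.+ (suc d ℕ.+ r) ≡ suc (u ℕ.+ d) ℕ.+ r
    position-after = ℕSolver.solve-∀

    -- A window right after a visit of κ: it is a sequence of gaps followed by a window
    -- without κ, so only that last window contributes an offset.
    ChainBound : ℕ → Set
    ChainBound l = ∀ u → mark u ≡ just κ → suc u ℕ.+ l ≤ N → MarksIn (κ ∷ Ls) (suc u) l →
                   Bound B' (suc c ℕ.* A) (suc u) l

    chain-step : ∀ l → (∀ {r} → r < l → ChainBound r) → ChainBound l
    chain-step l rec u mu hN win with search (λ j → visit? (suc u ℕ.+ j)) l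
    ... | absent none = bound-scale c (inner (suc u) l hN (marks-avoid none win))
    ... | least d d<l mv before with ℕP.m≤n⇒∃[o]m+o≡n d<l
    ...   | r , refl = bound-append gap (subst (λ p → Bound B' (suc c ℕ.* A) p r) (sym (ℕP.+-suc (suc u) d)) rest)
      where
      hN' : suc (suc u ℕ.+ d) ℕ.+ r ≤ N
      hN' = subst (_≤ N) (position-after (suc u) d r) hN
      gap : Bound B' 0 (suc u) (suc d)
      gap = gap-bound u d (ℕP.≤-trans (ℕP.m≤m+n _ r) hN') mu mv
              (marks-avoid before (marks-prefix (ℕP.<⇒≤ d<l) win))
      rest : Bound B' (suc c ℕ.* A) (suc (suc u ℕ.+ d)) r
      rest = rec (ℕP.m<n+m r (s≤s z≤n)) (suc u ℕ.+ d) mv hN'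
               (subst (λ p → MarksIn (κ ∷ Ls) p r) (ℕP.+-suc (suc u) d) (marks-suffix (suc d) win))

    chain : ∀ l → ChainBound l
    chain = <-rec ChainBound chain-step

    -- A general window: a prefix without κ, the first visit of κ, then a chain.
    level : ∀ a l → a ℕ.+ l ≤ N → MarksIn (κ ∷ Ls) a l →
            Bound (slope (coefficientsFor T (κ ∷ Ls))) (offset (coefficientsFor T (κ ∷ Ls))) a l
    level a l hN win with search (λ j → visit? (a ℕ.+ j)) l
    ... | absent none =
      bound-weaken (ℕP.≤-trans (ℕP.m≤m+n _ _) (ℕP.m≤m+n _ _))
        (bound-scale c (inner a l hN (marks-avoid none win)))
    ... | least d d<l mv before with ℕP.m≤n⇒∃[o]m+o≡n d<l
    ...   | r , refl = bound-append first-visit (subst (λ p → Bound B' (suc c ℕ.* A) p r) (sym (ℕP.+-suc a d)) rest)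
      where
      prefix : Bound B' (suc c ℕ.* A) a d
      prefix = bound-scale c (inner a d (ℕP.≤-trans (ℕP.+-monoʳ-≤ a (ℕP.<⇒≤ d<l)) hN)
                 (marks-avoid before (marks-prefix (ℕP.<⇒≤ d<l) win)))
      first-visit : Bound B' (suc c ℕ.* A ℕ.+ (B' ℕ.* T ℕ.+ 1)) a (suc d)
      first-visit = bound-extend prefix (x-lower (a ℕ.+ d))
      rest : Bound B' (suc c ℕ.* A) (suc (a ℕ.+ d)) r
      rest = chain r (a ℕ.+ d) mv (subst (_≤ N) (position-after a d r) hN)
               (subst (λ p → MarksIn (κ ∷ Ls) p r) (ℕP.+-suc a d) (marks-suffix (suc d) win))

  window-bound : ∀ Ls a l → a ℕ.+ l ≤ N → MarksIn Ls a l →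
                 Bound (slope (coefficientsFor T Ls)) (offset (coefficientsFor T Ls)) a l
  window-bound []       a l _ win = unmarked-bound a l win
  window-bound (κ ∷ Ls)           = Level.level κ Ls (window-bound Ls)

toℚᵘ-/ : ∀ (i : ℤ) k → ℚ.toℚᵘ (i ℚ./ suc k) ℚᵘ.≃ ℚᵘ.mkℚᵘ i k
toℚᵘ-/ i k = ℚP.toℚᵘ-fromℚᵘ (ℚᵘ.mkℚᵘ i k)

/-≤⇐ : ∀ i j a b → i * + suc b ≤ᶻ j * + suc a → (i ℚ./ suc a) ℚ.≤ (j ℚ./ suc b)
/-≤⇐ i j a b cross = ℚP.toℚᵘ-cancel-≤
  (ℚᵘP.≤-respˡ-≃ (ℚᵘP.≃-sym (toℚᵘ-/ i a)) (ℚᵘP.≤-respʳ-≃ (ℚᵘP.≃-sym (toℚᵘ-/ j b)) (ℚᵘ.*≤* cross)))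

/-≤-+⇒ : ∀ (W : ℤ) m T d k → (W ℚ./ suc m) ℚ.≤ (+ T ℚ./ suc d) ℚ.+ (1ℤ ℚ./ suc k) →
         W * + (suc d ℕ.* suc k) ≤ᶻ (+ T * + suc k + 1ℤ * + suc d) * + suc m
/-≤-+⇒ W m T d k h with ℚᵘP.≤-respˡ-≃ (toℚᵘ-/ W m) (ℚᵘP.≤-respʳ-≃ sum≃ (ℚP.toℚᵘ-mono-≤ h))
  where
  sum≃ : ℚ.toℚᵘ ((+ T ℚ./ suc d) ℚ.+ (1ℤ ℚ./ suc k)) ℚᵘ.≃ ℚᵘ.mkℚᵘ (+ T) d ℚᵘ.+ ℚᵘ.mkℚᵘ 1ℤ k
  sum≃ = ℚᵘP.≃-trans (ℚP.toℚᵘ-homo-+ (+ T ℚ./ suc d) (1ℤ ℚ./ suc k)) (ℚᵘP.+-cong (toℚᵘ-/ (+ T) d) (toℚᵘ-/ 1ℤ k))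
... | ℚᵘ.*≤* cross = cross

unit-fraction-pos : ∀ k → ℚ.0ℚ ℚ.< (1ℤ ℚ./ suc k)
unit-fraction-pos k = ℚP.toℚᵘ-cancel-< (ℚᵘP.<-respʳ-≃ (ℚᵘP.≃-sym (toℚᵘ-/ 1ℤ k)) (ℚᵘ.*<* (+<+ (s≤s z≤n))))

-- ⌈p⌉ = −⌊−p⌋ dominates p; first for the integer division underlying ⌊_⌋.
≤-negated-floor : ∀ i k → i ≤ᶻ (- ((- i) ℤD./ (+ suc k))) * + suc k
≤-negated-floor i k = subst₂ _≤ᶻ_ (ℤP.neg-involutive i) (ℤP.neg-distribˡ-* ((- i) ℤD./ (+ suc k)) (+ suc k))
  (ℤP.neg-mono-≤ (ℤD.[n/d]*d≤n (- i) (+ suc k)))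

-- ↥p ≤ ⌈p⌉·↧p (splitting the numerator lets ⌈_⌉ compute).
numerator-≤-ceiling : ∀ (p : ℚ.ℚ) → ℚ.↥ p ≤ᶻ ℚ.ceiling p * ℚ.↧ p
numerator-≤-ceiling (ℚ.mkℚ (+ zero)  k _) = ≤-negated-floor (+ zero) k
numerator-≤-ceiling (ℚ.mkℚ (+ suc i) k _) = ≤-negated-floor (+ suc i) k
numerator-≤-ceiling (ℚ.mkℚ -[1+ i ] k _) = ≤-negated-floor -[1+ i ] k

≤-ceiling : ∀ T d → + T ≤ᶻ + suc d * ℚ.ceiling (+ T ℚ./ suc d)
≤-ceiling T d = subst₂ _≤ᶻ_ numerator denominator (ℤP.*-monoˡ-≤-nonNeg g (numerator-≤-ceiling q))
  where
  q : ℚ.ℚ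
  q = + T ℚ./ suc d
  g : ℤ
  g = gcd (+ T) (+ suc d)
  numerator : g * ℚ.↥ q ≡ + T
  numerator = trans (ℤP.*-comm g _) (ℚP.↥-/ (+ T) (suc d))
  denominator : g * (ℚ.ceiling q * ℚ.↧ q) ≡ + suc d * ℚ.ceiling q
  denominator = begin
    g * (ℚ.ceiling q * ℚ.↧ q) ≡⟨ cong (g *_) (ℤP.*-comm (ℚ.ceiling q) (ℚ.↧ q)) ⟩
    g * (ℚ.↧ q * ℚ.ceiling q) ≡⟨ sym (ℤP.*-assoc g (ℚ.↧ q) (ℚ.ceiling q)) ⟩
    (g * ℚ.↧ q) * ℚ.ceiling q ≡⟨ cong (_* ℚ.ceiling q) (trans (ℤP.*-comm g (ℚ.↧ q)) (ℚP.↧-/ (+ T) (suc d))) ⟩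
    + suc d * ℚ.ceiling q     ∎
    where open ≡-Reasoning

-- Here W is the weight of the
-- original sequence and D·W − T·L that of the shifted one.
linear-vs-mean : ∀ B D T A L (W : ℤ) →
  + L ≤ᶻ + B * (+ D * W - + T * + L) + + A →
  W * + (D ℕ.* suc (B ℕ.* D)) ≤ᶻ (+ T * + suc (B ℕ.* D) + 1ℤ * + D) * + L →
  L ℕ.≤ suc (B ℕ.* D) ℕ.* A
linear-vs-mean B D T A L W long mean = ℤP.drop‿+≤+ $ begin
  + L                                               ≡⟨ peel (+ B) (+ D) (+ L) ⟩
  (1ℤ + + B * + D) * + L - + B * (+ D * + L)        ≡⟨ cong (λ e → e * + L - + B * (+ D * + L)) (sym E≡) ⟩
  + E * + L - + B * (+ D * + L)                     ≤⟨ ℤP.+-monoˡ-≤ (- (+ B * (+ D * + L))) scaled ⟩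
  (+ B * (+ D * + L) + + E * + A) - + B * (+ D * + L) ≡⟨ cancel (+ B * (+ D * + L)) (+ E * + A) ⟩
  + E * + A                                         ≡⟨ sym (ℤP.pos-* E A) ⟩
  + (E ℕ.* A)                                       ∎
  where
  open ℤP.≤-Reasoning
  E : ℕ
  E = suc (B ℕ.* D)
  X : ℤ
  X = + D * W - + T * + L
  E≡ : + E ≡ 1ℤ + + B * + D
  E≡ = cong (λ k → 1ℤ + k) (ℤP.pos-* B D)
  peel : ∀ b d l → l ≡ (1ℤ + b * d) * l - b * (d * l)
  peel = solve-∀
  cancel : ∀ y z → (y + z) - y ≡ z
  cancel = solve-∀
  shifted : + E * X ≤ᶻ + D * + L
  shifted = begin
    + E * X                                           ≡⟨ expand W (+ D) (+ E) (+ T) (+ L) ⟩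
    W * (+ D * + E) - (+ T * + E) * + L               ≡⟨ cong (λ k → W * k - (+ T * + E) * + L) (sym (ℤP.pos-* D E)) ⟩
    W * + (D ℕ.* E) - (+ T * + E) * + L               ≤⟨ ℤP.+-monoˡ-≤ (- ((+ T * + E) * + L)) mean ⟩
    (+ T * + E + 1ℤ * + D) * + L - (+ T * + E) * + L  ≡⟨ collect (+ T * + E) (+ D) (+ L) ⟩
    + D * + L                                         ∎
    where
    expand : ∀ w d e t l → e * (d * w - t * l) ≡ w * (d * e) - (t * e) * l
    expand = solve-∀
    collect : ∀ te d l → (te + 1ℤ * d) * l - te * l ≡ d * l
    collect = solve-∀
  scaled : + E * + L ≤ᶻ + B * (+ D * + L) + + E * + A
  scaled = begin
    + E * + L                       ≤⟨ ℤP.*-monoˡ-≤-nonNeg (+ E) long ⟩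
    + E * (+ B * X + + A)           ≡⟨ distrib (+ E) (+ B) X (+ A) ⟩
    + B * (+ E * X) + + E * + A     ≤⟨ ℤP.+-monoˡ-≤ (+ E * + A) (ℤP.*-monoˡ-≤-nonNeg (+ B) shifted) ⟩
    + B * (+ D * + L) + + E * + A   ∎
    where
    distrib : ∀ e b x a → e * (b * x + a) ≡ b * (e * x) + e * a
    distrib = solve-∀

≤-moveʳ : ∀ {a b c} → a + b ≤ᶻ c → a ≤ᶻ c - b
≤-moveʳ {a} {b} {c} h = subst (_≤ᶻ c - b) (cancel a b) (ℤP.+-monoˡ-≤ (- b) h)
  where
  cancel : ∀ a b → a + b - b ≡ a
  cancel = solve-∀

just? : ∀ {A : Set} (m : Maybe A) → Dec (∃ λ a → m ≡ just a)
just? (just a) = yes (a , refl)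
just? nothing  = no λ { (_ , ()) }

wsum-sumFrom : ∀ {n} (π : ℕ → Edge' n) a l → wsum π a l ≡ sumFrom (λ i → wt (π i)) a l
wsum-sumFrom π a zero    = refl
wsum-sumFrom π a (suc l) = cong (λ s → wt (π a) + s) (wsum-sumFrom π (suc a) l)

module ExpandedPlay {n : ℕ} (G : Game n) (T d : ℕ) (e : ℕ → Edge' n)
  (valid : ∀ i → IsEdge' G (thr T (suc d)) (e i))
  (connect : ∀ i → tgt (e i) ≡ src (e (suc i))) where

  D : ℕ
  D = suc d

  t : ℚ.ℚ
  t = thr T D

  data TargetWeight : Conf n → ℤ → Set where
    into-cfg : ∀ s c → TargetWeight (cfg s c) (+ c)
    into-bot : TargetWeight bot (ℚ.ceiling t + 1ℤ)

  target-weight : ∀ {ed} → IsEdge' G t ed → TargetWeight (tgt ed) (wt ed)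
  target-weight (step {s' = s'} {c' = c'} _ _) = into-cfg s' c'
  target-weight (toBot _ _)                    = into-bot
  target-weight botLoop                        = into-bot

  lowMark : Conf n → Maybe (Fin n × ℕ)
  lowMark (cfg s c) with D ℕ.* c ℕ.≤? T
  ... | yes _ = just (s , c)
  ... | no _  = nothing
  lowMark bot = nothing

  lowMark-just : ∀ σ {s c} → lowMark σ ≡ just (s , c) → σ ≡ cfg s c × D ℕ.* c ℕ.≤ T
  lowMark-just (cfg s c) eq with D ℕ.* c ℕ.≤? T
  lowMark-just (cfg s c) refl | yes Dc≤T = refl , Dc≤T

  lowMark-nothing : ∀ {s c} → lowMark (cfg s c) ≡ nothing → T ℕ.< D ℕ.* c
  lowMark-nothing {s} {c} eq with D ℕ.* c ℕ.≤? T
  ... | no Dc≰T = ℕP.≰⇒> Dc≰T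

  -- Shifted weights D·w − T: a segment has mean weight ≤ t iff its shifted weight is ≤ 0.
  x : ℕ → ℤ
  x i = + D * wt (e i) - + T

  mark : ℕ → Maybe (Fin n × ℕ)
  mark i = lowMark (tgt (e i))

  shifted-weight-pos : ∀ {σ w} → TargetWeight σ w → lowMark σ ≡ nothing → 1ℤ ≤ᶻ + D * w - + T
  shifted-weight-pos (into-cfg s c) unmarked =
    ≤-moveʳ (subst (1ℤ + + T ≤ᶻ_) (ℤP.pos-* D c) (+≤+ (lowMark-nothing unmarked)))
  shifted-weight-pos into-bot _ = ≤-moveʳ (begin
    1ℤ + + T                  ≤⟨ ℤP.+-mono-≤ (+≤+ (s≤s z≤n)) (≤-ceiling T d) ⟩
    + D + + D * ℚ.ceiling t   ≡⟨ distrib (+ D) (ℚ.ceiling t) ⟩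
    + D * (ℚ.ceiling t + 1ℤ)  ∎)
    where
    open ℤP.≤-Reasoning
    distrib : ∀ a k → a + a * k ≡ a * (k + 1ℤ)
    distrib = solve-∀

  shifted-weight-lower : ∀ {σ w} → TargetWeight σ w → - + T ≤ᶻ + D * w - + T
  shifted-weight-lower (into-cfg s c) = subst (λ k → - + T ≤ᶻ k - + T) (ℤP.pos-* D c) (ℤP.i≤j+i (- + T) (+ (D ℕ.* c)))
  shifted-weight-lower into-bot      = ℤP.≤-trans (ℤP.neg-≤-pos {T} {1}) (shifted-weight-pos into-bot refl)

  x-unmarked : ∀ i → mark i ≡ nothing → 1ℤ ≤ᶻ x i
  x-unmarked i = shifted-weight-pos (target-weight (valid i))

  x-lower : ∀ i → - + T ≤ᶻ x i
  x-lower i = shifted-weight-lower (target-weight (valid i))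

  window-weight : ∀ a l → sumFrom x a l ≡ + D * wsum e a l - + T * + l
  window-weight a l = trans (sumFrom-affine (+ D) (+ T) (λ i → wt (e i)) a l)
    (cong (λ s → + D * s - + T * + l) (sym (wsum-sumFrom e a l)))

  lowConfs : List (Fin n × ℕ)
  lowConfs = cartesianProduct (allFin n) (upTo (suc T))

  mark-low : ∀ i {κ} → mark i ≡ just κ → κ ∈ lowConfs
  mark-low i {s , c} eq =
    ∈-cartesianProduct⁺ (∈-allFin s) (∈-upTo⁺ (s≤s (ℕP.≤-trans (ℕP.m≤n*m c D) (proj₂ (lowMark-just (tgt (e i)) eq)))))

  _≟ᴹ_ : DecidableEquality (Fin n × ℕ)
  _≟ᴹ_ = ×-≡-dec Fin._≟_ ℕ._≟_

  good-cycle : ∀ u r {s c} → mark u ≡ just (s , c) → mark (suc u ℕ.+ r) ≡ just (s , c) →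
               sumFrom x (suc u) (suc r) ≤ᶻ 0ℤ → GoodCycle e t (suc u) (suc u ℕ.+ r)
  good-cycle u r {s} {c} mu mv nonpos = closes , (s , c , starts , counter≤t) , mean≤t
    where
    at-u : tgt (e u) ≡ cfg s c × D ℕ.* c ℕ.≤ T
    at-u = lowMark-just (tgt (e u)) mu
    starts : src (e (suc u)) ≡ cfg s c
    starts = trans (sym (connect u)) (proj₁ at-u)
    closes : tgt (e (suc u ℕ.+ r)) ≡ src (e (suc u))
    closes = trans (proj₁ (lowMark-just (tgt (e (suc u ℕ.+ r))) mv)) (sym starts)
    counter≤t : (+ c) ℚ./ 1 ℚ.≤ t
    counter≤t = /-≤⇐ (+ c) (+ T) 0 d
      (subst₂ _≤ᶻ_ (trans (ℤP.pos-* D c) (ℤP.*-comm (+ D) (+ c))) (sym (ℤP.*-identityʳ (+ T))) (+≤+ (proj₂ at-u)))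
    W : ℤ
    W = wsum e (suc u) (suc r)
    cross : W * + D ≤ᶻ + T * + suc r
    cross = subst (_≤ᶻ + T * + suc r) (ℤP.*-comm (+ D) W)
      (ℤP.i-j≤0⇒i≤j (subst (_≤ᶻ 0ℤ) (window-weight (suc u) (suc r)) nonpos))
    mean≤t : mpSeg e (suc u) ((suc u ℕ.+ r) ℕ.∸ suc u) ℚ.≤ t
    mean≤t = subst (λ k → mpSeg e (suc u) k ℚ.≤ t) (sym (ℕP.m+n∸m≡n (suc u) r)) (/-≤⇐ W (+ T) r d cross)

  BadRevisit : ℕ → ℕ → ℕ → Set
  BadRevisit N u r = suc u ℕ.+ r < N × (∃ λ κ → mark u ≡ just κ) ×
                     mark (suc u ℕ.+ r) ≡ mark u × sumFrom x (suc u) (suc r) ≤ᶻ 0ℤ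

  BadBelow : ℕ → Set
  BadBelow N = ∃ λ u → u < N × ∃ λ r → r < N × BadRevisit N u r

  bad-below? : ∀ N → Dec (BadBelow N)
  bad-below? N = search? (λ u → search? (λ r → bad? u r) N) N
    where
    bad? : ∀ u r → Dec (BadRevisit N u r)
    bad? u r = (suc u ℕ.+ r ℕ.<? N) ×-dec just? (mark u) ×-dec
               MaybeP.≡-dec _≟ᴹ_ (mark (suc u ℕ.+ r)) (mark u) ×-dec (sumFrom x (suc u) (suc r) ≤ᶻ? 0ℤ)

  good-cycle-of : ∀ {N} → BadBelow N → Σ ℕ λ i → Σ ℕ λ j → i ≤ j × GoodCycle e t i j
  good-cycle-of (u , _ , r , _ , _ , (κ , mu) , mv , nonpos) =
    suc u , suc u ℕ.+ r , ℕP.m≤m+n (suc u) r , good-cycle u r mu (trans mv mu) nonpos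

  revisits-pos : ∀ N → ¬ BadBelow N → ∀ u r {κ} → suc u ℕ.+ r < N → mark u ≡ just κ →
                 mark (suc u ℕ.+ r) ≡ just κ → 1ℤ ≤ᶻ sumFrom x (suc u) (suc r)
  revisits-pos N none u r lt mu mv with sumFrom x (suc u) (suc r) ≤ᶻ? 0ℤ
  ... | yes nonpos = ⊥-elim (none (u , u<N , r , r<N , lt , (_ , mu) , trans mv (sym mu) , nonpos))
    where
    u<N : u < N
    u<N = ℕP.≤-trans (s≤s (ℕP.m≤m+n u r)) (ℕP.<⇒≤ lt)
    r<N : r < N
    r<N = ℕP.≤-<-trans (ℕP.m≤n+m r (suc u)) lt
  ... | no positive = ℤP.i<j⇒suc[i]≤j (ℤP.≰⇒> positive)

lemma6 : {n : ℕ} (G : Game n) (sinit : Fin n) (t₁ t₂ : ℕ) .{{_ : NonZero t₂}} →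
    (π : Play G (thr t₁ t₂) (cfg sinit 0)) →
    LimsupMP≤ (edge π) (thr t₁ t₂) →
    Σ ℕ λ i → Σ ℕ λ j → i ≤ j × GoodCycle (edge π) (thr t₁ t₂) i j
-- t₂ = 0 contradicts NonZero t₂.
lemma6 G sinit t₁ zero {{t₂≢0}} π lim = ⊥-elim (ℕ.≢-nonZero⁻¹ 0 {{t₂≢0}} refl)
lemma6 G sinit t₁ (suc d) π lim = conclude (bad-below? N)
  where
  open ExpandedPlay G t₁ d (edge π) (valid π) (connect π)
  C : Coefficients
  C = coefficientsFor t₁ lowConfs
  -- tolerance 1 / (1 + B·D) on the mean payoff, and a horizon N beyond the offset it allows
  E : ℕ
  E = slope C ℕ.* D
  eventually : Σ ℕ λ N₀ → (m : ℕ) → N₀ ≤ m → mpSeg (edge π) 0 m ℚ.≤ t ℚ.+ (1ℤ ℚ./ suc E)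
  eventually = lim (1ℤ ℚ./ suc E) (unit-fraction-pos E)
  m N : ℕ
  m = proj₁ eventually ℕ.+ suc E ℕ.* offset C
  N = suc m

  conclude : Dec (BadBelow N) → Σ ℕ λ i → Σ ℕ λ j → i ≤ j × GoodCycle (edge π) t i j
  -- either a bad revisit below N is a good cycle, or the prefix of length N is linearly
  -- bounded, which forces its mean above t + 1/(1 + B·D) although N exceeds N₀
  conclude (yes bad) = good-cycle-of bad
  conclude (no none) = ⊥-elim (ℕP.<-irrefl refl (ℕP.≤-trans N≤offset (ℕP.m≤n+m _ (proj₁ eventually))))
    where
    open Revisits _≟ᴹ_ mark x t₁ x-unmarked x-lower N (revisits-pos N none)
    open Linear x using (Bound)
    long : Bound (slope C) (offset C) 0 N
    long = window-bound lowConfs 0 N ℕP.≤-refl (λ j _ → mark-low j)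
    N≤offset : N ℕ.≤ suc E ℕ.* offset C
    N≤offset = linear-vs-mean (slope C) D t₁ (offset C) N (wsum (edge π) 0 N)
      (subst (λ s → + N ≤ᶻ + slope C * s + + offset C) (window-weight 0 N) (Bound.bounded long))
      (/-≤-+⇒ (wsum (edge π) 0 N) m t₁ d E (proj₂ eventually m (ℕP.m≤m+n _ _)))
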